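{- A finite graded poset $P$ is $(2+2)$-avoiding if and only if both of the following hold: (1) for each rank $i$, the up-sets $US(p)$, $p\in P(i)$, form a chain under inclusion (equivalently, the down-sets of the elements of $P(i+1)$ form a chain under inclusion); (2) every rank of $P$ contains at least one all-seeing vertex.
   Context: A finite poset is graded if all maximal chains have the same number of elements; then each element has a rank (minimal elements rank $0$, covering increases rank by $1$), and $P(i)$ denotes the set of elements of rank $i$. $P$ contains $(2+2)$ if there are $a<b$ and $c<d$ with each of $a,b$ incomparable to each of $c,d$; otherwise it avoids $(2+2)$. For $p\in P(i)$, the up-set $US(p)$ is the set of elements covering $p$ and the down-set $DS(p)$ is the set of elements covered by $p$. $p$ is up-seeing if $US(p)=P(i+1)$, down-seeing if $DS(p)=P(i-1)$ (with $P(j)=\emptyset$ for ranks $j$ outside the range), and all-seeing if it is both. -}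

module Defs where

open import Data.Nat using (ℕ; zero; suc)
open import Data.Fin using (Fin)
open import Data.Fin.Subset using (Subset; _∈_; _⊆_; ∣_∣)
open import Data.Product using (_×_; ∃; ∃-syntax; Σ-syntax)
open import Data.Sum using (_⊎_)
open import Relation.Nullary using (¬_)
open import Relation.Binary.PropositionalEquality using (_≡_; _≢_)
open import Relation.Binary.Structures using (IsDecPartialOrder)
open import Function.Bundles using (_⇔_)

record FinPoset (n : ℕ) : Set₁ where
  field
    _≤_ : Fin n → Fin n → Set
    isDecPartialOrder : IsDecPartialOrder _≡_ _≤_

module _ {n : ℕ} (P : FinPoset n) where
  open FinPoset P

  _<_ : Fin n → Fin n → Set
  x < y = x ≤ y × x ≢ y

  _⋖_ : Fin n → Fin n → Set
  x ⋖ y = x < y × (∀ z → ¬ (x < z × z < y))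

  Incomparable : Fin n → Fin n → Set
  Incomparable x y = ¬ (x ≤ y) × ¬ (y ≤ x)

  Minimal : Fin n → Set
  Minimal x = ∀ y → y ≤ x → y ≡ x

  IsChain : Subset n → Set
  IsChain S = ∀ x y → x ∈ S → y ∈ S → (x ≤ y) ⊎ (y ≤ x)

  IsMaximalChain : Subset n → Set
  IsMaximalChain S = IsChain S × (∀ T → IsChain T → S ⊆ T → T ⊆ S)

  Graded : Set
  Graded = ∀ S T → IsMaximalChain S → IsMaximalChain T → ∣ S ∣ ≡ ∣ T ∣

  IsRank : (Fin n → ℕ) → Set
  IsRank ρ = (∀ x → Minimal x → ρ x ≡ 0) × (∀ x y → x ⋖ y → ρ y ≡ suc (ρ x))

  Contains22 : Set
  Contains22 = ∃[ a ] ∃[ b ] ∃[ c ] ∃[ d ]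
    (a < b × c < d × Incomparable a c × Incomparable a d
           × Incomparable b c × Incomparable b d)

  Avoids22 : Set
  Avoids22 = ¬ Contains22

  module _ (ρ : Fin n → ℕ) where

    _US⊆_ : Fin n → Fin n → Set
    p US⊆ q = ∀ x → p ⋖ x → q ⋖ x

    UpSetsChain : Set
    UpSetsChain = ∀ (i : ℕ) p q → ρ p ≡ i → ρ q ≡ i → (p US⊆ q) ⊎ (q US⊆ p)

    UpSeeing : Fin n → Set
    UpSeeing p = ∀ x → (p ⋖ x) ⇔ (ρ x ≡ suc (ρ p))

    -- DS(p) = P(rank p - 1)  (empty when rank p = 0)
    DownSeeing : Fin n → Set
    DownSeeing p = ∀ x → (x ⋖ p) ⇔ (suc (ρ x) ≡ ρ p)

    AllSeeing : Fin n → Set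
    AllSeeing p = UpSeeing p × DownSeeing p

    EveryRankAllSeeing : Set
    EveryRankAllSeeing = ∀ (i : ℕ) → (∃[ p ] ρ p ≡ i) → ∃[ q ] (ρ q ≡ i × AllSeeing q)

-- In a (2+2)-free poset the up-sets (and dually the down-sets) of one rank form a chain: covers p ⋖ x,
-- q ⋖ y with q ⋪ x and p ⋪ y would be a (2+2).  So in each rank an element with the largest down-set sees
-- the whole rank below (gradedness gives every element of lower rank an upper cover), and among those an
-- element x with the largest up-set is all-seeing: if x ⋪ y with ρ y = ρ x + 1, let b be the lower cover of
-- y with the largest down-set; b cannot see all of the rank below (else y would cover x), and any w it
-- misses gives the (2+2) w < x, b < y.
-- Conversely, all-seeing vertices give x < y whenever ρ y ≥ ρ x + 2, so in a (2+2) a < b, c < d the ranks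
-- force a ⋖ b, c ⋖ d with ρ a = ρ c, and comparable up-sets of a and c then give a < d or c < b.
module Submission where

open import Defs
open import Level using (0ℓ)
open import Data.Nat using (ℕ; zero; suc; _+_; _∸_) renaming (_≤_ to _≤ℕ_; _<_ to _<ℕ_)
import Data.Nat as ℕ
import Data.Nat.Properties as ℕ
open import Data.Fin using (Fin; _≟_)
open import Data.Fin.Properties using (any?; all?)
open import Data.Fin.Induction using (po-wellFounded; po-noetherian)
open import Data.Fin.Subset using (Subset; _∈_; _∉_; ∣_∣; _∪_; ⁅_⁆; inside; outside)
open import Data.Fin.Subset.Properties
  using (x∈⁅x⁆; x∈⁅y⁆⇒x≡y; ∪-identityʳ; x∈p∪q⁻; p⊆p∪q; q⊆p∪q; ∣⁅x⁆∣≡1)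
open import Data.Vec using (_∷_; here; there)
open import Data.List using (List; []; _∷_; allFin)
import Data.List.Relation.Unary.Any as Any
open import Data.List.Membership.Propositional using () renaming (_∈_ to _∈ˡ_)
open import Data.List.Membership.Propositional.Properties using (∈-allFin)
open import Data.Product using (_×_; _,_; proj₁; proj₂; ∃; swap)
open import Data.Sum using (_⊎_; inj₁; inj₂; [_,_]′)
open import Function using (_∘_; flip)
open import Function.Bundles using (_⇔_; mk⇔; Equivalence)
open import Relation.Nullary using (¬_; Dec; yes; no; contradiction)
open import Relation.Nullary.Decidable using (_×-dec_; _→-dec_; ¬?; map′; decidable-stable)
open import Relation.Unary using (Pred; Decidable; _⊆′_)
open import Relation.Unary.Properties using (⊆′-refl; ⊆′-trans)
open import Relation.Binary using (Rel; Reflexive; Transitive)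
open import Relation.Binary.PropositionalEquality using (_≡_; _≢_; refl; sym; trans; cong; subst; module ≡-Reasoning)
open import Relation.Binary.Structures using (IsDecPartialOrder)
open import Induction.WellFounded using (Acc; acc)

∣p∪⁅x⁆∣≡1+∣p∣ : ∀ {m} {x : Fin m} {p : Subset m} → x ∉ p → ∣ p ∪ ⁅ x ⁆ ∣ ≡ suc ∣ p ∣
∣p∪⁅x⁆∣≡1+∣p∣ {x = Fin.zero}  {outside ∷ p} x∉p = cong (suc ∘ ∣_∣) (∪-identityʳ p)
∣p∪⁅x⁆∣≡1+∣p∣ {x = Fin.zero}  {inside ∷ p}  x∉p = contradiction here x∉p
∣p∪⁅x⁆∣≡1+∣p∣ {x = Fin.suc x} {outside ∷ p} x∉p = ∣p∪⁅x⁆∣≡1+∣p∣ (x∉p ∘ there)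
∣p∪⁅x⁆∣≡1+∣p∣ {x = Fin.suc x} {inside ∷ p}  x∉p = cong suc (∣p∪⁅x⁆∣≡1+∣p∣ (x∉p ∘ there))

⊆′-or-counterexample : ∀ {n} {U V : Pred (Fin n) 0ℓ} → Decidable U → Decidable V →
                       U ⊆′ V ⊎ ∃ λ x → U x × ¬ V x
⊆′-or-counterexample U? V? with any? (λ x → U? x ×-dec ¬? (V? x))
... | yes counterexample = inj₂ counterexample
... | no ∄counterexample =
  inj₁ λ x Ux → decidable-stable (V? x) λ ¬Vx → ∄counterexample (x , Ux , ¬Vx)

⊆′-total-or-crossing : ∀ {n} {U V : Pred (Fin n) 0ℓ} → Decidable U → Decidable V →
                       (U ⊆′ V ⊎ V ⊆′ U) ⊎ ((∃ λ x → U x × ¬ V x) × (∃ λ y → V y × ¬ U y))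
⊆′-total-or-crossing U? V? with ⊆′-or-counterexample U? V? | ⊆′-or-counterexample V? U?
... | inj₁ U⊆V | _        = inj₁ (inj₁ U⊆V)
... | inj₂ _   | inj₁ V⊆U = inj₁ (inj₂ V⊆U)
... | inj₂ x   | inj₂ y   = inj₂ (x , y)

module _ {A : Set} {S : Pred A 0ℓ} (S? : Decidable S) (R : Rel A 0ℓ)
         (R-refl : Reflexive R) (R-trans : Transitive R)
         (R-total : ∀ {a b} → S a → S b → R a b ⊎ R b a) where

  greatestInList : ∀ {s} → S s → (xs : List A) →
                   ∃ λ m → S m × (∀ {z} → z ∈ˡ xs → S z → R z m)
  greatestInList Ss [] = _ , Ss , λ ()
  greatestInList Ss (x ∷ xs) with greatestInList Ss xs
  ... | m , Sm , m-greatest with S? x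
  ...   | no ¬Sx = m , Sm , λ { (Any.here refl) Sx → contradiction Sx ¬Sx
                              ; (Any.there z∈xs) → m-greatest z∈xs }
  ...   | yes Sx with R-total Sx Sm
  ...     | inj₁ xRm = m , Sm , λ { (Any.here refl) _ → xRm
                                  ; (Any.there z∈xs) → m-greatest z∈xs }
  ...     | inj₂ mRx = x , Sx , λ { (Any.here refl) _ → R-refl
                                  ; (Any.there z∈xs) Sz → R-trans (m-greatest z∈xs Sz) mRx }

greatest : ∀ {n} {S : Pred (Fin n) 0ℓ} → Decidable S → (R : Rel (Fin n) 0ℓ) →
           Reflexive R → Transitive R → (∀ {a b} → S a → S b → R a b ⊎ R b a) →
           ∀ {s} → S s → ∃ λ m → S m × (∀ z → S z → R z m)
greatest {n} S? R R-refl R-trans R-total Ss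
  with greatestInList S? R R-refl R-trans R-total Ss (allFin n)
... | m , Sm , m-greatest = m , Sm , λ z → m-greatest (∈-allFin z)

module RankedPoset {n : ℕ} (P : FinPoset n) (ρ : Fin n → ℕ) (ρ-isRank : IsRank P ρ) where
  open FinPoset P
  open IsDecPartialOrder isDecPartialOrder
    using (_≤?_; antisym; isPartialOrder)
    renaming (refl to ≤-refl; trans to ≤-trans; reflexive to ≤-reflexive)

  infix 4 _<ₚ_ _⋖ₚ_
  _<ₚ_ : Fin n → Fin n → Set
  _<ₚ_ = _<_ P

  _⋖ₚ_ : Fin n → Fin n → Set
  _⋖ₚ_ = _⋖_ P

  UpSet DownSet : Fin n → Pred (Fin n) 0ℓ
  UpSet p = p ⋖ₚ_
  DownSet p = _⋖ₚ p

  ρ-⋖ : ∀ {x y} → x ⋖ₚ y → ρ y ≡ suc (ρ x)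
  ρ-⋖ = proj₂ ρ-isRank _ _

  _<?_ : ∀ x y → Dec (x <ₚ y)
  x <? y = (x ≤? y) ×-dec ¬? (x ≟ y)

  ≤⇒≡⊎< : ∀ {x y} → x ≤ y → x ≡ y ⊎ x <ₚ y
  ≤⇒≡⊎< {x} {y} x≤y with x ≟ y
  ... | yes x≡y = inj₁ x≡y
  ... | no x≢y = inj₂ (x≤y , x≢y)

  <⇒≤⋖ : ∀ {x y} → x <ₚ y → ∃ λ z → x ≤ z × z ⋖ₚ y
  <⇒≤⋖ {x} {y} = go x (po-noetherian isPartialOrder x)
    where
    go : ∀ x → Acc (flip _<ₚ_) x → x <ₚ y → ∃ λ z → x ≤ z × z ⋖ₚ y
    go x (acc rec) x<y with any? (λ t → (x <? t) ×-dec (t <? y))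
    ... | no ∄t = x , ≤-refl , x<y , λ t x<t<y → ∄t (t , x<t<y)
    ... | yes (t , x<t , t<y) with go t (rec x<t) t<y
    ...   | z , t≤z , z⋖y = z , ≤-trans (proj₁ x<t) t≤z , z⋖y

  <⇒⋖≤ : ∀ {x y} → x <ₚ y → ∃ λ z → x ⋖ₚ z × z ≤ y
  <⇒⋖≤ {x} {y} = go y (po-wellFounded isPartialOrder y)
    where
    go : ∀ y → Acc _<ₚ_ y → x <ₚ y → ∃ λ z → x ⋖ₚ z × z ≤ y
    go y (acc rec) x<y with any? (λ t → (x <? t) ×-dec (t <? y))
    ... | no ∄t = y , (x<y , λ t x<t<y → ∄t (t , x<t<y)) , ≤-refl
    ... | yes (t , x<t , t<y) with go t (rec t<y) x<t
    ...   | z , x⋖z , z≤t = z , x⋖z , ≤-trans z≤t (proj₁ t<y)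

  ρ-mono-< : ∀ {x y} → x <ₚ y → ρ x <ℕ ρ y
  ρ-mono-< {x} {y} = go y (po-wellFounded isPartialOrder y)
    where
    go : ∀ y → Acc _<ₚ_ y → x <ₚ y → ρ x <ℕ ρ y
    go y (acc rec) x<y with <⇒≤⋖ x<y
    ... | z , x≤z , z⋖y with ≤⇒≡⊎< x≤z
    ...   | inj₁ refl = ℕ.≤-reflexive (sym (ρ-⋖ z⋖y))
    ...   | inj₂ x<z  = ℕ.<-trans (go z (rec (proj₁ z⋖y)) x<z) (ℕ.≤-reflexive (sym (ρ-⋖ z⋖y)))

  ρ-mono-≤ : ∀ {x y} → x ≤ y → ρ x ≤ℕ ρ y
  ρ-mono-≤ x≤y with ≤⇒≡⊎< x≤y
  ... | inj₁ refl = ℕ.≤-refl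
  ... | inj₂ x<y  = ℕ.<⇒≤ (ρ-mono-< x<y)

  ρ<⇒≱ : ∀ {x y} → ρ x <ℕ ρ y → ¬ y ≤ x
  ρ<⇒≱ ρx<ρy y≤x = ℕ.<⇒≱ ρx<ρy (ρ-mono-≤ y≤x)

  ≤∧ρ<⇒< : ∀ {x y} → x ≤ y → ρ x <ℕ ρ y → x <ₚ y
  ≤∧ρ<⇒< x≤y ρx<ρy = x≤y , λ x≡y → ℕ.<-irrefl (cong ρ x≡y) ρx<ρy

  ≤∧ρ≡⇒≡ : ∀ {x y} → x ≤ y → ρ x ≡ ρ y → x ≡ y
  ≤∧ρ≡⇒≡ x≤y ρx≡ρy with ≤⇒≡⊎< x≤y
  ... | inj₁ x≡y = x≡y
  ... | inj₂ x<y = contradiction ρx≡ρy (ℕ.<⇒≢ (ρ-mono-< x<y))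

  ≤∧ρ≡1+⇒⋖ : ∀ {x y} → x ≤ y → ρ y ≡ suc (ρ x) → x ⋖ₚ y
  ≤∧ρ≡1+⇒⋖ x≤y ρy≡ =
    ≤∧ρ<⇒< x≤y (ℕ.≤-reflexive (sym ρy≡)) ,
    λ z (x<z , z<y) → ℕ.<⇒≱ (ρ-mono-< x<z) (ℕ.≤-pred (subst (ρ z <ℕ_) ρy≡ (ρ-mono-< z<y)))

  _⋖?_ : ∀ x y → Dec (x ⋖ₚ y)
  x ⋖? y = map′ (λ (x≤y , ρy≡) → ≤∧ρ≡1+⇒⋖ x≤y ρy≡) (λ x⋖y → proj₁ (proj₁ x⋖y) , ρ-⋖ x⋖y)
                ((x ≤? y) ×-dec (ρ y ℕ.≟ suc (ρ x)))

  lowerCover : ∀ {y k} → ρ y ≡ suc k → ∃ λ z → z ⋖ₚ y × ρ z ≡ k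
  lowerCover {y} ρy≡ with ⊆′-or-counterexample (_≤? y) (_≟ y)
  ... | inj₁ y-minimal = contradiction (trans (sym (proj₁ ρ-isRank y y-minimal)) ρy≡) ℕ.0≢1+n
  ... | inj₂ (x , x≤y , x≢y) with <⇒≤⋖ (x≤y , x≢y)
  ...   | z , _ , z⋖y = z , z⋖y , ℕ.suc-injective (trans (sym (ρ-⋖ z⋖y)) ρy≡)

  ∃-below-of-rank : ∀ {k y} → k ≤ℕ ρ y → ∃ λ z → z ≤ y × ρ z ≡ k
  ∃-below-of-rank {k} {y} k≤ρy = go (ρ y ∸ k) (ℕ.m∸n+n≡m k≤ρy)
    where
    go : ∀ d {x} → d + k ≡ ρ x → ∃ λ z → z ≤ x × ρ z ≡ k
    go zero {x} ρx≡ = x , ≤-refl , sym ρx≡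
    go (suc d) ρx≡ with lowerCover (sym ρx≡)
    ... | z , z⋖x , ρz≡ with go d (sym ρz≡)
    ...   | w , w≤z , ρw≡ = w , ≤-trans w≤z (proj₁ (proj₁ z⋖x)) , ρw≡

  ≤∧ρ≡2+⇒⋖⋖ : ∀ {x y} → x ≤ y → ρ y ≡ 2 + ρ x → ∃ λ z → x ⋖ₚ z × z ⋖ₚ y
  ≤∧ρ≡2+⇒⋖⋖ x≤y ρy≡ with <⇒≤⋖ (≤∧ρ<⇒< x≤y (ℕ.<⇒≤ (ℕ.≤-reflexive (sym ρy≡))))
  ... | z , x≤z , z⋖y = z , ≤∧ρ≡1+⇒⋖ x≤z (ℕ.suc-injective (trans (sym (ρ-⋖ z⋖y)) ρy≡)) , z⋖y

  ρ≡∧≢⇒incomparable : ∀ {x y} → ρ x ≡ ρ y → x ≢ y → Incomparable P x y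
  ρ≡∧≢⇒incomparable ρx≡ρy x≢y =
    (λ x≤y → x≢y (≤∧ρ≡⇒≡ x≤y ρx≡ρy)) , (λ y≤x → x≢y (sym (≤∧ρ≡⇒≡ y≤x (sym ρx≡ρy))))

  ρ≡1+∧⋪⇒incomparable : ∀ {x y} → ρ y ≡ suc (ρ x) → ¬ x ⋖ₚ y → Incomparable P x y
  ρ≡1+∧⋪⇒incomparable ρy≡ x⋪y =
    (λ x≤y → x⋪y (≤∧ρ≡1+⇒⋖ x≤y ρy≡)) , ρ<⇒≱ (ℕ.≤-reflexive (sym ρy≡))

  crossedCovers⇒contains22 : ∀ {a b c d} → a ⋖ₚ b → c ⋖ₚ d → ρ a ≡ ρ c →
                             ¬ a ⋖ₚ d → ¬ c ⋖ₚ b → Contains22 P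
  crossedCovers⇒contains22 {a} {b} {c} {d} a⋖b c⋖d ρa≡ρc a⋪d c⋪b =
    a , b , c , d , proj₁ a⋖b , proj₁ c⋖d ,
    ρ≡∧≢⇒incomparable ρa≡ρc a≢c ,
    ρ≡1+∧⋪⇒incomparable (trans (ρ-⋖ c⋖d) (cong suc (sym ρa≡ρc))) a⋪d ,
    swap (ρ≡1+∧⋪⇒incomparable (trans (ρ-⋖ a⋖b) (cong suc ρa≡ρc)) c⋪b) ,
    ρ≡∧≢⇒incomparable (trans (ρ-⋖ a⋖b) (trans (cong suc ρa≡ρc) (sym (ρ-⋖ c⋖d)))) b≢d
    where
    a≢c : a ≢ c
    a≢c refl = a⋪d c⋖d
    b≢d : b ≢ d
    b≢d refl = a⋪d a⋖b

  avoids⇒upSetsChain : Avoids22 P → UpSetsChain P ρ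
  avoids⇒upSetsChain avoids i p q refl ρq≡ρp with ⊆′-total-or-crossing (p ⋖?_) (q ⋖?_)
  ... | inj₁ comparable = comparable
  ... | inj₂ ((x , p⋖x , q⋪x) , (y , q⋖y , p⋪y)) =
    contradiction (crossedCovers⇒contains22 p⋖x q⋖y (sym ρq≡ρp) p⋪y q⋪x) avoids

  avoids⇒downSetsChain : Avoids22 P → ∀ {p q} → ρ p ≡ ρ q →
                         DownSet p ⊆′ DownSet q ⊎ DownSet q ⊆′ DownSet p
  avoids⇒downSetsChain avoids {p} {q} ρp≡ρq with ⊆′-total-or-crossing (_⋖? p) (_⋖? q)
  ... | inj₁ comparable = comparable
  ... | inj₂ ((w , w⋖p , w⋪q) , (v , v⋖q , v⋪p)) =
    contradiction (crossedCovers⇒contains22 w⋖p v⋖q ρw≡ρv w⋪q v⋪p) avoids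
    where
    ρw≡ρv : ρ w ≡ ρ v
    ρw≡ρv = ℕ.suc-injective (trans (sym (ρ-⋖ w⋖p)) (trans ρp≡ρq (ρ-⋖ v⋖q)))

  Maximal : Fin n → Set
  Maximal x = ∀ y → x ≤ y → y ≡ x

  ∃-maximal-above : ∀ x → ∃ λ m → x ≤ m × Maximal m
  ∃-maximal-above x
    with greatest (x ≤?_) (λ a b → ρ a ≤ℕ ρ b) ℕ.≤-refl ℕ.≤-trans (λ _ _ → ℕ.≤-total _ _) ≤-refl
  ... | m , x≤m , m-greatest = m , x≤m , λ y m≤y →
    sym (≤∧ρ≡⇒≡ m≤y (ℕ.≤-antisym (ρ-mono-≤ m≤y) (m-greatest y (≤-trans x≤m m≤y))))

  -- A chain x₀ ⋖ x₁ ⋖ ⋯ ⋖ x with ρ x₀ = 0; the last field makes it a maximal chain of ↓x.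
  record SaturatedChain (x : Fin n) : Set where
    field
      elements : Subset n
      isChain : IsChain P elements
      top∈ : x ∈ elements
      ≤top : ∀ s → s ∈ elements → s ≤ x
      ∣elements∣ : ∣ elements ∣ ≡ suc (ρ x)
      maximalBelowTop : ∀ t → t ≤ x → (∀ s → s ∈ elements → t ≤ s ⊎ s ≤ t) → t ∈ elements

  singletonChain : ∀ {x} → ρ x ≡ 0 → SaturatedChain x
  singletonChain {x} ρx≡0 = record
    { elements = ⁅ x ⁆
    ; isChain = λ a b a∈ b∈ → inj₁ (≤-reflexive (trans (x∈⁅y⁆⇒x≡y x a∈) (sym (x∈⁅y⁆⇒x≡y x b∈))))
    ; top∈ = x∈⁅x⁆ x
    ; ≤top = λ s s∈ → ≤-reflexive (x∈⁅y⁆⇒x≡y x s∈)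
    ; ∣elements∣ = trans (∣⁅x⁆∣≡1 x) (cong suc (sym ρx≡0))
    ; maximalBelowTop = λ t t≤x _ → subst (_∈ ⁅ x ⁆) (sym (≤∧ρ≡⇒≡ t≤x (ρ≡ t≤x))) (x∈⁅x⁆ x)
    }
    where
    ρ≡ : ∀ {t} → t ≤ x → ρ t ≡ ρ x
    ρ≡ {t} t≤x = trans (ℕ.n≤0⇒n≡0 (subst (ρ t ≤ℕ_) ρx≡0 (ρ-mono-≤ t≤x))) (sym ρx≡0)

  extendChain : ∀ {z x} → z ⋖ₚ x → SaturatedChain z → SaturatedChain x
  extendChain {z} {x} z⋖x C = record
    { elements = C.elements ∪ ⁅ x ⁆
    ; isChain = isChain
    ; top∈ = q⊆p∪q C.elements ⁅ x ⁆ (x∈⁅x⁆ x)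
    ; ≤top = ≤top
    ; ∣elements∣ = trans (∣p∪⁅x⁆∣≡1+∣p∣ x∉C) (cong suc (trans C.∣elements∣ (sym (ρ-⋖ z⋖x))))
    ; maximalBelowTop = maximalBelowTop
    }
    where
    module C = SaturatedChain C
    z<x = proj₁ z⋖x

    x∉C : x ∉ C.elements
    x∉C x∈C = proj₂ z<x (antisym (proj₁ z<x) (C.≤top x x∈C))

    ≤top : ∀ s → s ∈ C.elements ∪ ⁅ x ⁆ → s ≤ x
    ≤top s s∈ with x∈p∪q⁻ C.elements ⁅ x ⁆ s∈
    ... | inj₁ s∈C = ≤-trans (C.≤top s s∈C) (proj₁ z<x)
    ... | inj₂ s∈x = ≤-reflexive (x∈⁅y⁆⇒x≡y x s∈x)

    isChain : IsChain P (C.elements ∪ ⁅ x ⁆)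
    isChain a b a∈ b∈ with x∈p∪q⁻ C.elements ⁅ x ⁆ a∈ | x∈p∪q⁻ C.elements ⁅ x ⁆ b∈
    ... | inj₁ a∈C | inj₁ b∈C = C.isChain a b a∈C b∈C
    ... | inj₁ _   | inj₂ b∈x = inj₁ (subst (a ≤_) (sym (x∈⁅y⁆⇒x≡y x b∈x)) (≤top a a∈))
    ... | inj₂ a∈x | _        = inj₂ (subst (b ≤_) (sym (x∈⁅y⁆⇒x≡y x a∈x)) (≤top b b∈))

    -- Nothing lies strictly between z and x, so t is either x or comparable below z.
    maximalBelowTop : ∀ t → t ≤ x → (∀ s → s ∈ C.elements ∪ ⁅ x ⁆ → t ≤ s ⊎ s ≤ t) →
                      t ∈ C.elements ∪ ⁅ x ⁆
    maximalBelowTop t t≤x comparable with ≤⇒≡⊎< t≤x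
    ... | inj₁ refl = q⊆p∪q C.elements ⁅ x ⁆ (x∈⁅x⁆ x)
    ... | inj₂ t<x with comparable z (p⊆p∪q ⁅ x ⁆ C.top∈)
    ...   | inj₁ t≤z = p⊆p∪q ⁅ x ⁆
      (C.maximalBelowTop t t≤z (λ s s∈C → comparable s (p⊆p∪q ⁅ x ⁆ s∈C)))
    ...   | inj₂ z≤t with ≤⇒≡⊎< z≤t
    ...     | inj₁ refl = p⊆p∪q ⁅ x ⁆ C.top∈
    ...     | inj₂ z<t  = contradiction (z<t , t<x) (proj₂ z⋖x t)

  saturatedChain : ∀ k {x} → ρ x ≡ k → SaturatedChain x
  saturatedChain zero ρx≡0 = singletonChain ρx≡0
  saturatedChain (suc k) ρx≡ with lowerCover ρx≡
  ... | z , z⋖x , ρz≡k = extendChain z⋖x (saturatedChain k ρz≡k)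

  chainTo : ∀ x → SaturatedChain x
  chainTo x = saturatedChain (ρ x) refl

  maximal⇒maximalChain : ∀ {m} → Maximal m → IsMaximalChain P (SaturatedChain.elements (chainTo m))
  maximal⇒maximalChain {m} m-maximal = C.isChain , λ T T-chain C⊆T {t} t∈T →
      C.maximalBelowTop t (t≤m T-chain (C⊆T C.top∈) t∈T)
                          (λ s s∈C → T-chain t s t∈T (C⊆T s∈C))
    where
    module C = SaturatedChain (chainTo m)
    t≤m : ∀ {T t} → IsChain P T → m ∈ T → t ∈ T → t ≤ m
    t≤m {t = t} T-chain m∈T t∈T with T-chain t m t∈T m∈T
    ... | inj₁ t≤m = t≤m
    ... | inj₂ m≤t = ≤-reflexive (m-maximal t m≤t)

  graded⇒maximal-ρ≡ : Graded P → ∀ {m m′} → Maximal m → Maximal m′ → ρ m ≡ ρ m′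
  graded⇒maximal-ρ≡ graded {m} {m′} m-maximal m′-maximal = ℕ.suc-injective (begin
    suc (ρ m)                               ≡⟨ sym (SaturatedChain.∣elements∣ (chainTo m)) ⟩
    ∣ SaturatedChain.elements (chainTo m) ∣  ≡⟨ graded _ _ (maximal⇒maximalChain m-maximal)
                                                          (maximal⇒maximalChain m′-maximal) ⟩
    ∣ SaturatedChain.elements (chainTo m′) ∣ ≡⟨ SaturatedChain.∣elements∣ (chainTo m′) ⟩
    suc (ρ m′)                              ∎)
    where open ≡-Reasoning

  graded⇒upperCover : Graded P → ∀ {w x} → ρ w <ℕ ρ x → ∃ λ z → w ⋖ₚ z
  graded⇒upperCover graded {w} {x} ρw<ρx with ⊆′-or-counterexample (w ≤?_) (_≟ w)
  ... | inj₂ (y , w≤y , y≢w) with <⇒⋖≤ (w≤y , y≢w ∘ sym)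
  ...   | z , w⋖z , _ = z , w⋖z
  graded⇒upperCover graded {w} {x} ρw<ρx | inj₁ w-maximal with ∃-maximal-above x
  ... | m , x≤m , m-maximal =
    contradiction (graded⇒maximal-ρ≡ graded w-maximal m-maximal)
                  (ℕ.<⇒≢ (ℕ.<-≤-trans ρw<ρx (ρ-mono-≤ x≤m)))

  SeesBelow : Pred (Fin n) 0ℓ
  SeesBelow y = ∀ w → suc (ρ w) ≡ ρ y → w ⋖ₚ y

  seesBelow? : Decidable SeesBelow
  seesBelow? y = all? (λ w → (suc (ρ w) ℕ.≟ ρ y) →-dec (w ⋖? y))

  seesBelow⇒downSeeing : ∀ {x} → SeesBelow x → DownSeeing P ρ x
  seesBelow⇒downSeeing x-sees w = mk⇔ (sym ∘ ρ-⋖) (x-sees w)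

  avoids⇒∃-seesBelow : Graded P → Avoids22 P → ∀ p → ∃ λ x → ρ x ≡ ρ p × SeesBelow x
  avoids⇒∃-seesBelow graded avoids p
    with greatest (λ y → ρ y ℕ.≟ ρ p) (λ a b → DownSet a ⊆′ DownSet b) ⊆′-refl ⊆′-trans
                  (λ ρa≡ρp ρb≡ρp → avoids⇒downSetsChain avoids (trans ρa≡ρp (sym ρb≡ρp))) {p} refl
  ... | x , ρx≡ρp , x-greatest = x , ρx≡ρp , x-sees
    where
    x-sees : SeesBelow x
    x-sees w 1+ρw≡ρx with graded⇒upperCover graded (ℕ.≤-reflexive 1+ρw≡ρx)
    ... | z , w⋖z = x-greatest z (trans (ρ-⋖ w⋖z) (trans 1+ρw≡ρx ρx≡ρp)) w w⋖z

  avoids⇒greatestLowerCover-seesBelow :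
    Avoids22 P → ∀ {x y b} → SeesBelow x → ¬ x ⋖ₚ y → ρ b ≡ ρ x → b ⋖ₚ y →
    (∀ z → ρ z ≡ ρ x × z ⋖ₚ y → DownSet z ⊆′ DownSet b) → SeesBelow b
  avoids⇒greatestLowerCover-seesBelow avoids {x} {y} {b} x-sees x⋪y ρb≡ρx b⋖y b-greatest
    with ⊆′-or-counterexample (λ w → suc (ρ w) ℕ.≟ ρ b) (_⋖? b)
  ... | inj₁ b-sees = b-sees
  ... | inj₂ (w , 1+ρw≡ρb , w⋪b) = contradiction
    ( w , x , b , y , proj₁ (x-sees w (trans 1+ρw≡ρb ρb≡ρx)) , proj₁ b⋖y
    , ρ≡1+∧⋪⇒incomparable (sym 1+ρw≡ρb) w⋪b , w∥y
    , ρ≡∧≢⇒incomparable (sym ρb≡ρx) x≢b , ρ≡1+∧⋪⇒incomparable ρy≡ x⋪y )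
    avoids
    where
    ρy≡ : ρ y ≡ suc (ρ x)
    ρy≡ = trans (ρ-⋖ b⋖y) (cong suc ρb≡ρx)
    ρy≡2+ρw : ρ y ≡ 2 + ρ w
    ρy≡2+ρw = trans (ρ-⋖ b⋖y) (cong suc (sym 1+ρw≡ρb))
    x≢b : x ≢ b
    x≢b refl = x⋪y b⋖y
    -- A chain w ⋖ z ⋖ y would put w in the down-set of z, hence of b.
    w≰y : ¬ w ≤ y
    w≰y w≤y with ≤∧ρ≡2+⇒⋖⋖ w≤y ρy≡2+ρw
    ... | z , w⋖z , z⋖y = w⋪b (b-greatest z (ρz≡ρx , z⋖y) w w⋖z)
      where
      ρz≡ρx : ρ z ≡ ρ x
      ρz≡ρx = ℕ.suc-injective (trans (sym (ρ-⋖ z⋖y)) ρy≡)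
    w∥y : Incomparable P w y
    w∥y = w≰y , ρ<⇒≱ (ℕ.<⇒≤ (ℕ.≤-reflexive (sym ρy≡2+ρw)))

  avoids⇒upSeeing : Avoids22 P → ∀ {x} → SeesBelow x →
                    (∀ z → ρ z ≡ ρ x × SeesBelow z → UpSet z ⊆′ UpSet x) → UpSeeing P ρ x
  avoids⇒upSeeing avoids {x} x-sees x-greatest y = mk⇔ ρ-⋖ x⋖y
    where
    x⋖y : ρ y ≡ suc (ρ x) → x ⋖ₚ y
    x⋖y ρy≡ with lowerCover ρy≡
    ... | z , z⋖y , ρz≡ρx
      with greatest (λ b → (ρ b ℕ.≟ ρ x) ×-dec (b ⋖? y)) (λ a b → DownSet a ⊆′ DownSet b)
                    ⊆′-refl ⊆′-trans
                    (λ a b → avoids⇒downSetsChain avoids (trans (proj₁ a) (sym (proj₁ b))))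
                    (ρz≡ρx , z⋖y)
    ...   | b , (ρb≡ρx , b⋖y) , b-greatest = decidable-stable (x ⋖? y) λ x⋪y →
      x⋪y (x-greatest b (ρb≡ρx , b-sees x⋪y) y b⋖y)
      where
      b-sees : ¬ x ⋖ₚ y → SeesBelow b
      b-sees x⋪y = avoids⇒greatestLowerCover-seesBelow avoids x-sees x⋪y ρb≡ρx b⋖y b-greatest

  avoids⇒everyRankAllSeeing : Graded P → Avoids22 P → EveryRankAllSeeing P ρ
  avoids⇒everyRankAllSeeing graded avoids i (p , refl) with avoids⇒∃-seesBelow graded avoids p
  ... | x₀ , ρx₀≡ρp , x₀-sees
    with greatest (λ z → (ρ z ℕ.≟ ρ p) ×-dec seesBelow? z) (λ a b → UpSet a ⊆′ UpSet b)
                  ⊆′-refl ⊆′-trans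
                  (λ a b → avoids⇒upSetsChain avoids (ρ p) _ _ (proj₁ a) (proj₁ b))
                  (ρx₀≡ρp , x₀-sees)
  ...   | x , (ρx≡ρp , x-sees) , x-greatest =
    x , ρx≡ρp ,
    avoids⇒upSeeing avoids x-sees (λ z (ρz≡ρx , z-sees) → x-greatest z (trans ρz≡ρx ρx≡ρp , z-sees)) ,
    seesBelow⇒downSeeing x-sees

  -- x ⋖ s ⋖ z ≤ y, where s is all-seeing of rank ρ x + 1 and z ≤ y has rank ρ x + 2.
  everyRankAllSeeing⇒< : EveryRankAllSeeing P ρ → ∀ {x y} → 2 + ρ x ≤ℕ ρ y → x <ₚ y
  everyRankAllSeeing⇒< allSeeing {x} {y} gap with ∃-below-of-rank gap | ∃-below-of-rank (ℕ.<⇒≤ gap)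
  ... | z , z≤y , ρz≡ | t , _ , ρt≡ with allSeeing (suc (ρ x)) (t , ρt≡)
  ...   | s , ρs≡ , s-up , s-down = ≤∧ρ<⇒< (≤-trans x≤s (≤-trans s≤z z≤y)) (ℕ.<⇒≤ gap)
    where
    x≤s : x ≤ s
    x≤s = proj₁ (proj₁ (Equivalence.from (s-down x) (sym ρs≡)))
    s≤z : s ≤ z
    s≤z = proj₁ (proj₁ (Equivalence.from (s-up z) (trans ρz≡ (cong suc (sym ρs≡)))))

  everyRankAllSeeing∧≰⇒ρ≤1+ : EveryRankAllSeeing P ρ → ∀ {x y} → ¬ x ≤ y → ρ y ≤ℕ suc (ρ x)
  everyRankAllSeeing∧≰⇒ρ≤1+ allSeeing x≰y =
    ℕ.≮⇒≥ λ gap → x≰y (proj₁ (everyRankAllSeeing⇒< allSeeing gap))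

  everyRankAllSeeing∧<∧≰⇒ρ≤ : EveryRankAllSeeing P ρ → ∀ {x y z} → x <ₚ y → ¬ z ≤ y →
                              ρ x ≤ℕ ρ z
  everyRankAllSeeing∧<∧≰⇒ρ≤ allSeeing x<y z≰y =
    ℕ.≤-pred (ℕ.<-≤-trans (ρ-mono-< x<y) (everyRankAllSeeing∧≰⇒ρ≤1+ allSeeing z≰y))

  everyRankAllSeeing∧<∧≰⇒⋖ : EveryRankAllSeeing P ρ → ∀ {x y z} → x <ₚ y → ¬ z ≤ y →
                             ρ z ≡ ρ x → x ⋖ₚ y
  everyRankAllSeeing∧<∧≰⇒⋖ allSeeing {x} {y} x<y z≰y ρz≡ρx =
    ≤∧ρ≡1+⇒⋖ (proj₁ x<y) (ℕ.≤-antisym ρy≤1+ρx (ρ-mono-< x<y))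
    where
    ρy≤1+ρx : ρ y ≤ℕ suc (ρ x)
    ρy≤1+ρx = subst (λ k → ρ y ≤ℕ suc k) ρz≡ρx (everyRankAllSeeing∧≰⇒ρ≤1+ allSeeing z≰y)

  upSetsChain∧everyRankAllSeeing⇒avoids : UpSetsChain P ρ → EveryRankAllSeeing P ρ → Avoids22 P
  upSetsChain∧everyRankAllSeeing⇒avoids upChain allSeeing
    (a , b , c , d , a<b , c<d , _ , (a≰d , _) , (_ , c≰b) , _) =
    [ (λ USa⊆USc → c≰b (proj₁ (proj₁ (USa⊆USc b a⋖b))))
    , (λ USc⊆USa → a≰d (proj₁ (proj₁ (USc⊆USa d c⋖d)))) ]′
    (upChain (ρ a) a c refl (sym ρa≡ρc))
    where
    ρa≡ρc : ρ a ≡ ρ c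
    ρa≡ρc = ℕ.≤-antisym (everyRankAllSeeing∧<∧≰⇒ρ≤ allSeeing a<b c≰b)
                        (everyRankAllSeeing∧<∧≰⇒ρ≤ allSeeing c<d a≰d)
    a⋖b : a ⋖ₚ b
    a⋖b = everyRankAllSeeing∧<∧≰⇒⋖ allSeeing a<b c≰b (sym ρa≡ρc)
    c⋖d : c ⋖ₚ d
    c⋖d = everyRankAllSeeing∧<∧≰⇒⋖ allSeeing c<d a≰d ρa≡ρc

lemma5p2 : (n : ℕ) (P : FinPoset n) → Graded P →
    (ρ : Fin n → ℕ) → IsRank P ρ →
    Avoids22 P ⇔ (UpSetsChain P ρ × EveryRankAllSeeing P ρ)
lemma5p2 n P graded ρ ρ-isRank = mk⇔
  (λ avoids → avoids⇒upSetsChain avoids , avoids⇒everyRankAllSeeing graded avoids)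
  (λ (upChain , allSeeing) → upSetsChain∧everyRankAllSeeing⇒avoids upChain allSeeing)
  where open RankedPoset P ρ ρ-isRank
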